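{- Let $s\ge1$, $1\le r\le k$ and $n\ge sk$ be integers. Then \[ S^{(s)}_r(n,k)=\binom{n-r}{s-1}S^{(s)}_{r-1}(n-s,k-1)+(k-r+1)\,S^{(s)}_{r-1}(n-1,k). \]
   Context: Fix an integer $s\ge1$. For integers $n,k,r\ge0$, $S^{(s)}_r(n,k)$ is the number of partitions of $\{1,\dots,n\}$ into exactly $k$ nonempty blocks such that $1,\dots,r$ lie in pairwise distinct blocks and every block has at least $s$ elements; it is taken to be $0$ if $n$ or $k$ is negative. -}

module Defs where

open import Data.Nat using (ℕ; zero; suc; _⊔_; _+_; _≤ᵇ_)
open import Data.Bool using (Bool; true; false; _∧_; not)
open import Data.Fin using (Fin; toℕ; _≟_)
open import Data.List using (List; []; _∷_; map; concatMap; allFin; take; length; filterᵇ)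
open import Data.Bool.ListAction using (all; any)
open import Data.Vec using (Vec; toList)
  renaming ([] to []ᵛ; _∷_ to _∷ᵛ_)
open import Relation.Nullary.Decidable using (⌊_⌋)

-- All label assignments v : {1..n} → {0..k-1}, encoded as vectors.
allVecs : (n k : ℕ) → List (Vec (Fin k) n)
allVecs zero    k = []ᵛ ∷ []
allVecs (suc n) k = concatMap (λ x → map (x ∷ᵛ_) (allVecs n k)) (allFin k)

-- Restricted growth condition: blocks are labelled 0,1,2,... in order of
-- their least elements.  `m` = number of labels used so far.
rgs : {k : ℕ} → ℕ → List (Fin k) → Bool
rgs m []       = true
rgs m (x ∷ xs) = (toℕ x ≤ᵇ m) ∧ rgs (m ⊔ suc (toℕ x)) xs

blockSize : {k : ℕ} → Fin k → List (Fin k) → ℕ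
blockSize b xs = length (filterᵇ (λ x → ⌊ x ≟ b ⌋) xs)

firstDistinct : {k : ℕ} → ℕ → List (Fin k) → Bool
firstDistinct zero    xs       = true
firstDistinct (suc r) []       = false
firstDistinct (suc r) (x ∷ xs) =
  not (any (λ y → ⌊ y ≟ x ⌋) (take r xs)) ∧ firstDistinct r xs

-- v encodes a partition of {1..n} into exactly k nonempty blocks (block of i
-- = label v_i, canonical labelling), each block of size ≥ s, with 1..r in
-- pairwise distinct blocks.
valid : (s r n k : ℕ) → Vec (Fin k) n → Bool
valid s r n k v =
  rgs 0 (toList v)
  ∧ all (λ b → 1 ≤ᵇ blockSize b (toList v)) (allFin k)
  ∧ all (λ b → s ≤ᵇ blockSize b (toList v)) (allFin k)
  ∧ firstDistinct r (toList v)

S : (s r n k : ℕ) → ℕ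
S s r n k = length (filterᵇ (valid s r n k) (allVecs n k))

module Submission where

-- S s r n k counts canonically labelled vectors (restricted growth strings), and
-- canonical labellings do not split well.  We therefore pass to ordinary labellings:
-- by symmetrisation, S s r n k · (k ∸ r)! counts all label vectors v ∈ (Fin k)ⁿ whose
-- first r labels are 0, …, r−1 and all of whose blocks have at least s elements.
-- Peeling off those r fixed positions leaves vectors of length n ∸ r in which each
-- label below r carries one seed element (seededCount).  For the label r−1 there are
-- two cases: its block holds exactly s−1 further elements, which are chosen in
-- binom(n−r, s−1) ways and deleted together with the label, or it is large without
-- its seed, so the seed can be dropped.  Read back through the factorials, the two
-- cases are the two terms of the recurrence.

open import Defs
open import Data.Nat using (ℕ; zero; suc; _+_; _*_; _∸_; _≤_; _<_; _⊔_; _≤ᵇ_; _!; z≤n; s≤s; s≤s⁻¹)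
open import Data.Nat.Properties hiding (_≟_)
open import Data.Nat.Properties using () renaming (_≟_ to _≟ℕ_)
open import Data.Nat.Combinatorics using (_C_; nCk+nC[k+1]≡[n+1]C[k+1]; k>n⇒nCk≡0)
open import Data.Nat.Solver using (module +-*-Solver)
open import Data.Bool using (Bool; true; false; T; _∧_; not; if_then_else_)
open import Data.Bool.Properties using (∧-assoc; ∧-comm; ∧-zeroʳ; ∧-identityʳ)
open import Data.Bool.ListAction using (all; any)
open import Data.Empty using (⊥-elim)
open import Data.Product using (_×_; _,_; proj₁; proj₂)
open import Data.Fin using (Fin; toℕ; _≟_; fromℕ<; punchIn; punchOut) renaming (zero to fzero; suc to fsuc)
open import Data.Fin.Properties using (toℕ-injective; toℕ-fromℕ<; toℕ<n; punchInᵢ≢i; punchIn-punchOut; punchIn-injective)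
open import Data.Fin.Permutation as Perm using (Permutation; _⟨$⟩ʳ_; _⟨$⟩ˡ_)
import Data.Fin.Permutation.Components as Transposition
open import Data.List using (List; []; _∷_; map; concatMap; allFin; length; filterᵇ; tabulate; take; _++_)
import Data.List.Relation.Unary.All as All
open import Data.List.Relation.Unary.All.Properties using (all⁺; all⁻; tabulate⁺)
open import Data.List.Membership.Propositional.Properties using (∈-allFin)
open import Data.Vec using (Vec; []; _∷_; toList) renaming (map to mapᵥ)
open import Data.Vec.Properties using (toList-map)
open import Function using (_∘_)
open import Relation.Nullary using (Dec; yes; no; does)
open import Relation.Nullary.Decidable using (dec-true; dec-false; ⌊_⌋)
open import Relation.Binary using (tri<; tri≈; tri>)
open import Relation.Binary.PropositionalEquality
open import Algebra.Properties.CommutativeSemigroup *-commutativeSemigroup using () renaming (x∙yz≈y∙xz to *-exchange)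
open import Algebra.Properties.CommutativeSemigroup +-commutativeSemigroup using () renaming (x∙yz≈y∙xz to +-exchange)
open import Algebra.Properties.Semiring.Sum +-*-semiring
  using (sum; sum-cong-≗; sum-permute; sum-remove; sum-replicate-zero; *-distribʳ-sum; *-distribˡ-sum)

bool-ext : ∀ {a b} → (T a → T b) → (T b → T a) → a ≡ b
bool-ext {false} {false} _ _ = refl
bool-ext {false} {true}  _ g = ⊥-elim (g _)
bool-ext {true}  {false} f _ = ⊥-elim (f _)
bool-ext {true}  {true}  _ _ = refl

count : {A : Set} → (A → Bool) → List A → ℕ
count P xs = length (filterᵇ P xs)

count-++ : {A : Set} (P : A → Bool) (xs ys : List A) → count P (xs ++ ys) ≡ count P xs + count P ys
count-++ P []       ys = refl
count-++ P (x ∷ xs) ys with P x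
... | true  = cong suc (count-++ P xs ys)
... | false = count-++ P xs ys

count-map : {A B : Set} (P : B → Bool) (f : A → B) (xs : List A) →
  count P (map f xs) ≡ count (P ∘ f) xs
count-map P f []       = refl
count-map P f (x ∷ xs) with P (f x)
... | true  = cong suc (count-map P f xs)
... | false = count-map P f xs

count-cong : {A : Set} {P Q : A → Bool} → (∀ x → P x ≡ Q x) → (xs : List A) → count P xs ≡ count Q xs
count-cong             e []       = refl
count-cong {P = P} {Q} e (x ∷ xs) with P x | Q x | e x
... | true  | true  | _ = cong suc (count-cong e xs)
... | false | false | _ = count-cong e xs

count-split : {A : Set} (P Q : A → Bool) (xs : List A) →
  count P xs ≡ count (λ x → P x ∧ Q x) xs + count (λ x → P x ∧ not (Q x)) xs
count-split P Q []       = refl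
count-split P Q (x ∷ xs) with P x | Q x
... | true  | true  = cong suc (count-split P Q xs)
... | true  | false = trans (cong suc (count-split P Q xs)) (sym (+-suc _ _))
... | false | _     = count-split P Q xs

count-none : {A : Set} (xs : List A) → count (λ _ → false) xs ≡ 0
count-none []       = refl
count-none (_ ∷ xs) = count-none xs

count-concatMap : {A B : Set} (P : B → Bool) {k : ℕ} (f : Fin k → A) (g : A → List B) →
  count P (concatMap g (tabulate f)) ≡ sum (λ i → count P (g (f i)))
count-concatMap P {zero}  f g = refl
count-concatMap P {suc k} f g =
  trans (count-++ P (g (f fzero)) _) (cong (count P (g (f fzero)) +_) (count-concatMap P (f ∘ fsuc) g))

countVec : ∀ L k → (Vec (Fin k) L → Bool) → ℕ
countVec L k P = count P (allVecs L k)

countVec-[] : ∀ k (P : Vec (Fin k) 0 → Bool) → countVec 0 k P ≡ (if P [] then 1 else 0)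
countVec-[] k P with P []
... | true  = refl
... | false = refl

countVec-∷ : ∀ L k (P : Vec (Fin k) (suc L) → Bool) →
  countVec (suc L) k P ≡ sum (λ x → countVec L k (λ v → P (x ∷ v)))
countVec-∷ L k P =
  trans (count-concatMap P {k} (λ x → x) (λ x → map (x ∷_) (allVecs L k))) (sum-cong-≗ (λ x → count-map P (x ∷_) (allVecs L k)))

countVec-cong : ∀ L k {P Q : Vec (Fin k) L → Bool} → (∀ v → P v ≡ Q v) → countVec L k P ≡ countVec L k Q
countVec-cong L k e = count-cong e (allVecs L k)

countVec-split : ∀ L k (P Q : Vec (Fin k) L → Bool) →
  countVec L k P ≡ countVec L k (λ v → P v ∧ Q v) + countVec L k (λ v → P v ∧ not (Q v))
countVec-split L k P Q = count-split P Q (allVecs L k)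

countVec-none : ∀ L k → countVec L k (λ _ → false) ≡ 0
countVec-none L k = count-none (allVecs L k)

countVec-relabel : ∀ L k (π : Permutation k k) (P : Vec (Fin k) L → Bool) →
  countVec L k (λ v → P (mapᵥ (π ⟨$⟩ʳ_) v)) ≡ countVec L k P
countVec-relabel zero    k π P = countVec-cong 0 k {λ v → P (mapᵥ (π ⟨$⟩ʳ_) v)} {P} (λ { [] → refl })
countVec-relabel (suc L) k π P = begin
  countVec (suc L) k (λ v → P (mapᵥ (π ⟨$⟩ʳ_) v))
    ≡⟨ countVec-∷ L k _ ⟩
  sum (λ x → countVec L k (λ v → P ((π ⟨$⟩ʳ x) ∷ mapᵥ (π ⟨$⟩ʳ_) v)))
    ≡⟨ sum-cong-≗ (λ x → countVec-relabel L k π (λ v → P ((π ⟨$⟩ʳ x) ∷ v))) ⟩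
  sum (λ x → countVec L k (λ v → P ((π ⟨$⟩ʳ x) ∷ v)))
    ≡⟨ sum-permute {k} {k} (λ y → countVec L k (λ v → P (y ∷ v))) π ⟨
  sum (λ y → countVec L k (λ v → P (y ∷ v)))
    ≡⟨ countVec-∷ L k P ⟨
  countVec (suc L) k P ∎
  where open ≡-Reasoning

sum-const : ∀ n c → sum (λ (_ : Fin n) → c) ≡ n * c
sum-const zero    c = refl
sum-const (suc n) c = cong (c +_) (sum-const n c)

sum-single : ∀ {n} (f : Fin (suc n) → ℕ) c → (∀ x → x ≢ c → f x ≡ 0) → sum f ≡ f c
sum-single {n} f c others-zero = begin
  sum f                             ≡⟨ sum-remove {n} {c} f ⟩
  f c + sum (f ∘ punchIn c)         ≡⟨ cong (f c +_) (sum-cong-≗ {n} (λ y → others-zero (punchIn c y) (punchInᵢ≢i c y))) ⟩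
  f c + sum (λ (_ : Fin n) → 0)     ≡⟨ cong (f c +_) (sum-replicate-zero n) ⟩
  f c + 0                           ≡⟨ +-identityʳ (f c) ⟩
  f c                               ∎
  where open ≡-Reasoning

sum-collapse : ∀ k m (F G : Fin k → ℕ) →
  (∀ x → toℕ x < m → F x ≡ G x) →
  (∀ x → m < toℕ x → F x ≡ 0) →
  (∀ x → toℕ x ≡ m → F x ≡ (k ∸ m) * G x) →
  (∀ x y → m ≤ toℕ x → toℕ y ≡ m → G x ≡ G y) →
  sum F ≡ sum G
sum-collapse zero    m       F G below above at same = refl
sum-collapse (suc k) zero    F G below above at same = begin
  F fzero + sum (F ∘ fsuc)          ≡⟨ cong₂ _+_ (at fzero refl) (sum-cong-≗ {k} (λ i → above (fsuc i) (s≤s z≤n))) ⟩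
  suc k * G fzero + sum (λ (_ : Fin k) → 0) ≡⟨ cong (suc k * G fzero +_) (sum-replicate-zero k) ⟩
  suc k * G fzero + 0               ≡⟨ +-identityʳ _ ⟩
  G fzero + k * G fzero             ≡⟨ cong (G fzero +_) (sum-const k (G fzero)) ⟨
  G fzero + sum (λ (_ : Fin k) → G fzero) ≡⟨ cong (G fzero +_) (sum-cong-≗ {k} (λ i → same (fsuc i) fzero z≤n refl)) ⟨
  G fzero + sum (G ∘ fsuc)          ∎
  where open ≡-Reasoning
sum-collapse (suc k) (suc m) F G below above at same =
  cong₂ _+_ (below fzero (s≤s z≤n))
    (sum-collapse k m (F ∘ fsuc) (G ∘ fsuc) (λ x p → below (fsuc x) (s≤s p)) (λ x p → above (fsuc x) (s≤s p))
      (λ x p → at (fsuc x) (cong suc p)) (λ x y p q → same (fsuc x) (fsuc y) (s≤s p) (cong suc q)))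

blockSize-hit : ∀ {k} (b : Fin k) l → blockSize b (b ∷ l) ≡ suc (blockSize b l)
blockSize-hit b l with b ≟ b
... | yes _   = refl
... | no  b≢b = ⊥-elim (b≢b refl)

blockSize-skip : ∀ {k} {x b : Fin k} l → x ≢ b → blockSize b (x ∷ l) ≡ blockSize b l
blockSize-skip {x = x} {b} l x≢b with x ≟ b
... | yes x≡b = ⊥-elim (x≢b x≡b)
... | no  _   = refl

transpose-fix : ∀ {k} (a b x : Fin k) → x ≢ a → x ≢ b → Transposition.transpose a b x ≡ x
transpose-fix a b x x≢a x≢b rewrite dec-false (x ≟ a) x≢a | dec-false (x ≟ b) x≢b = refl

transpose-right : ∀ {k} (a b : Fin k) → Transposition.transpose a b b ≡ a
transpose-right a b with b ≟ a
... | yes b≡a = b≡a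
... | no  _   rewrite dec-true (b ≟ b) refl = refl

startsWithRun : ∀ {k L} → ℕ → ℕ → Vec (Fin k) L → Bool
startsWithRun m zero    v       = true
startsWithRun m (suc j) []      = false
startsWithRun m (suc j) (x ∷ v) = does (toℕ x ≟ℕ m) ∧ startsWithRun (suc m) j v

canonicalRun : ∀ {k L} → ℕ → ℕ → Vec (Fin k) L → Bool
canonicalRun m zero    v       = rgs m (toList v)
canonicalRun m (suc j) []      = false
canonicalRun m (suc j) (x ∷ v) = does (toℕ x ≟ℕ m) ∧ canonicalRun (suc m) j v

Invariant : ∀ {k L} → ℕ → (Vec (Fin k) L → Bool) → Set
Invariant {k} m P = ∀ (π : Permutation k k) → (∀ b → toℕ b < m → π ⟨$⟩ʳ b ≡ b) →
  ∀ v → P (mapᵥ (π ⟨$⟩ʳ_) v) ≡ P v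

Covering : ∀ {k L} → ℕ → (Vec (Fin k) L → Bool) → Set
Covering {k} m P = ∀ v → T (P v) → ∀ (b : Fin k) → m ≤ toℕ b → 1 ≤ blockSize b (toList v)

invariant-∷ : ∀ {k L m m′} {x : Fin k} {P : Vec (Fin k) (suc L) → Bool} →
  Invariant m P → toℕ x < m′ → m ≤ m′ → Invariant m′ (λ v → P (x ∷ v))
invariant-∷ {x = x} {P} inv x<m′ m≤m′ π fix v =
  trans (cong (λ y → P (y ∷ mapᵥ (π ⟨$⟩ʳ_) v)) (sym (fix x x<m′)))
        (inv π (λ b b<m → fix b (<-≤-trans b<m m≤m′)) (x ∷ v))

covering-∷ : ∀ {k L m m′} {x : Fin k} {P : Vec (Fin k) (suc L) → Bool} →
  Covering m P → toℕ x < m′ → m ≤ m′ → Covering m′ (λ v → P (x ∷ v))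
covering-∷ {x = x} cov x<m′ m≤m′ v Pxv b m′≤b =
  subst (1 ≤_) (blockSize-skip (toList v) x≢b) (cov (x ∷ v) Pxv b (≤-trans m≤m′ m′≤b))
  where
  x≢b : x ≢ b
  x≢b refl = <⇒≱ x<m′ m′≤b

invariant-head : ∀ {k L m} (P : Vec (Fin k) (suc L) → Bool) → Invariant m P →
  ∀ x y → m ≤ toℕ x → m ≤ toℕ y →
  countVec L k (λ v → P (x ∷ v)) ≡ countVec L k (λ v → P (y ∷ v))
invariant-head {k} {L} {m} P inv x y m≤x m≤y = begin
  countVec L k (λ v → P (x ∷ v))                 ≡⟨ countVec-relabel L k τ (λ v → P (x ∷ v)) ⟨
  countVec L k (λ v → P (x ∷ mapᵥ (τ ⟨$⟩ʳ_) v))  ≡⟨ countVec-cong L k swap ⟩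
  countVec L k (λ v → P (y ∷ v))                 ∎
  where
  open ≡-Reasoning
  τ = Perm.transpose x y
  τ-fix : ∀ b → toℕ b < m → τ ⟨$⟩ʳ b ≡ b
  τ-fix b b<m = transpose-fix x y b (λ { refl → <⇒≱ b<m m≤x }) (λ { refl → <⇒≱ b<m m≤y })
  swap : ∀ v → P (x ∷ mapᵥ (τ ⟨$⟩ʳ_) v) ≡ P (y ∷ v)
  swap v = trans (cong (λ z → P (z ∷ mapᵥ (τ ⟨$⟩ʳ_) v)) (sym (transpose-right x y))) (inv τ τ-fix (y ∷ v))

factorial-step : ∀ k m → m < k → (k ∸ m) ! ≡ (k ∸ m) * (k ∸ suc m) !
factorial-step k m m<k rewrite +-∸-assoc 1 m<k = refl

∸-shift : ∀ k m j → k ∸ m ∸ suc j ≡ k ∸ suc m ∸ j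
∸-shift k m j = begin
  k ∸ m ∸ suc j     ≡⟨ ∸-+-assoc k m (suc j) ⟩
  k ∸ (m + suc j)   ≡⟨ cong (k ∸_) (+-suc m j) ⟩
  k ∸ (suc m + j)   ≡⟨ ∸-+-assoc k (suc m) j ⟨
  k ∸ suc m ∸ j     ∎
  where open ≡-Reasoning

-- For P invariant under renaming the labels ≥ m and forcing them all
-- to occur, every vector starting with the run m, …, m+j−1 arises from exactly one
-- canonical vector by renaming the k ∸ m ∸ j labels ≥ m+j; hence the two counts differ
-- by the factor (k ∸ m ∸ j)!.
Symmetrisation : ℕ → ℕ → Set
Symmetrisation k L = ∀ m j (P : Vec (Fin k) L → Bool) → Invariant m P → Covering m P →
  countVec L k (λ v → canonicalRun m j v ∧ P v) * (k ∸ m ∸ j) !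
    ≡ countVec L k (λ v → startsWithRun m j v ∧ P v)

-- The empty vector uses no label, so P [] forces that no label ≥ m exists.
symmetrisation-[] : ∀ k → Symmetrisation k 0
symmetrisation-[] k m (suc j) P inv cov = refl
symmetrisation-[] k m zero    P inv cov
  rewrite countVec-[] k (λ v → canonicalRun m zero v ∧ P v) | countVec-[] k (λ v → startsWithRun m zero v ∧ P v)
  with P [] in P[]
... | false = refl
... | true  = trans (+-identityʳ _) (cong _! no-free-label)
  where
  no-free-label : k ∸ m ≡ 0
  no-free-label with m <? k
  ... | yes m<k = ⊥-elim (<⇒≱ (s≤s z≤n) (cov [] (subst T (sym P[]) _) (fromℕ< m<k) (≤-reflexive (sym (toℕ-fromℕ< m<k)))))
  ... | no  m≮k = m≤n⇒m∸n≡0 (≮⇒≥ m≮k)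

-- A pending run forces the head to be m, which then becomes an open label.
symmetrisation-run : ∀ k L → Symmetrisation k L → ∀ m j (P : Vec (Fin k) (suc L) → Bool) → Invariant m P → Covering m P →
  countVec (suc L) k (λ v → canonicalRun m (suc j) v ∧ P v) * (k ∸ m ∸ suc j) !
    ≡ countVec (suc L) k (λ v → startsWithRun m (suc j) v ∧ P v)
symmetrisation-run k L ih m j P inv cov = begin
  countVec (suc L) k (λ v → canonicalRun m (suc j) v ∧ P v) * c
    ≡⟨ cong (_* c) (countVec-∷ L k _) ⟩
  sum (λ x → countVec L k (λ v → (does (toℕ x ≟ℕ m) ∧ canonicalRun (suc m) j v) ∧ P (x ∷ v))) * c
    ≡⟨ *-distribʳ-sum {k} c _ ⟩
  sum (λ x → countVec L k (λ v → (does (toℕ x ≟ℕ m) ∧ canonicalRun (suc m) j v) ∧ P (x ∷ v)) * c)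
    ≡⟨ sum-cong-≗ {k} head ⟩
  sum (λ x → countVec L k (λ v → (does (toℕ x ≟ℕ m) ∧ startsWithRun (suc m) j v) ∧ P (x ∷ v)))
    ≡⟨ countVec-∷ L k _ ⟨
  countVec (suc L) k (λ v → startsWithRun m (suc j) v ∧ P v) ∎
  where
  open ≡-Reasoning
  c = (k ∸ m ∸ suc j) !
  head : ∀ x → countVec L k (λ v → (does (toℕ x ≟ℕ m) ∧ canonicalRun (suc m) j v) ∧ P (x ∷ v)) * c
             ≡ countVec L k (λ v → (does (toℕ x ≟ℕ m) ∧ startsWithRun (suc m) j v) ∧ P (x ∷ v))
  head x with toℕ x ≟ℕ m
  ... | no  x≢m rewrite dec-false (toℕ x ≟ℕ m) x≢m | countVec-none L k = refl
  ... | yes x≡m rewrite dec-true (toℕ x ≟ℕ m) x≡m =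
    trans (cong (λ e → countVec L k (λ v → canonicalRun (suc m) j v ∧ P (x ∷ v)) * e !) (∸-shift k m j))
          (ih (suc m) j (λ v → P (x ∷ v)) (invariant-∷ inv x<m+1 (n≤1+n m)) (covering-∷ cov x<m+1 (n≤1+n m)))
    where
    x<m+1 : toℕ x < suc m
    x<m+1 = s≤s (≤-reflexive x≡m)

-- Without a pending run, restricted growth lets the head reuse a label < m or open the
-- label m; the latter stands for the k ∸ m equally frequent heads ≥ m.
symmetrisation-open : ∀ k L → Symmetrisation k L → ∀ m (P : Vec (Fin k) (suc L) → Bool) → Invariant m P → Covering m P →
  countVec (suc L) k (λ v → rgs m (toList v) ∧ P v) * (k ∸ m) ! ≡ countVec (suc L) k P
symmetrisation-open k L ih m P inv cov = begin
  countVec (suc L) k (λ v → rgs m (toList v) ∧ P v) * (k ∸ m) !  ≡⟨ cong (_* (k ∸ m) !) (countVec-∷ L k _) ⟩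
  sum F′ * (k ∸ m) !                                             ≡⟨ *-distribʳ-sum ((k ∸ m) !) F′ ⟩
  sum F                                                          ≡⟨ sum-collapse k m F G below above at same ⟩
  sum G                                                          ≡⟨ countVec-∷ L k P ⟨
  countVec (suc L) k P                                           ∎
  where
  open ≡-Reasoning
  F′ F G : Fin k → ℕ
  F′ x = countVec L k (λ v → ((toℕ x ≤ᵇ m) ∧ rgs (m ⊔ suc (toℕ x)) (toList v)) ∧ P (x ∷ v))
  F x = F′ x * (k ∸ m) !
  G x = countVec L k (λ v → P (x ∷ v))
  below : ∀ x → toℕ x < m → F x ≡ G x
  below x x<m rewrite dec-true (toℕ x ≤? m) (<⇒≤ x<m) | m≥n⇒m⊔n≡m x<m =
    ih m zero (λ v → P (x ∷ v)) (invariant-∷ inv x<m ≤-refl) (covering-∷ cov x<m ≤-refl)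
  above : ∀ x → m < toℕ x → F x ≡ 0
  above x m<x rewrite dec-false (toℕ x ≤? m) (<⇒≱ m<x) | countVec-none L k = refl
  at : ∀ x → toℕ x ≡ m → F x ≡ (k ∸ m) * G x
  at x refl rewrite dec-true (toℕ x ≤? toℕ x) ≤-refl | m≤n⇒m⊔n≡n (n≤1+n (toℕ x)) = begin
    A * (k ∸ m) !                   ≡⟨ cong (A *_) (factorial-step k m (toℕ<n x)) ⟩
    A * ((k ∸ m) * (k ∸ suc m) !)   ≡⟨ *-exchange A (k ∸ m) _ ⟩
    (k ∸ m) * (A * (k ∸ suc m) !)   ≡⟨ cong ((k ∸ m) *_) opened ⟩
    (k ∸ m) * G x                   ∎
    where
    A = countVec L k (λ v → rgs (suc m) (toList v) ∧ P (x ∷ v))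
    opened : A * (k ∸ suc m) ! ≡ G x
    opened = ih (suc m) zero (λ v → P (x ∷ v)) (invariant-∷ inv ≤-refl (n≤1+n m)) (covering-∷ cov ≤-refl (n≤1+n m))
  same : ∀ x y → m ≤ toℕ x → toℕ y ≡ m → G x ≡ G y
  same x y m≤x y≡m = invariant-head P inv x y m≤x (≤-reflexive (sym y≡m))

symmetrisation : ∀ k L → Symmetrisation k L
symmetrisation k zero    = symmetrisation-[] k
symmetrisation k (suc L) m zero    = symmetrisation-open k L (symmetrisation k L) m
symmetrisation k (suc L) m (suc j) = symmetrisation-run k L (symmetrisation k L) m j

∧-exchange : ∀ a b c → a ∧ (b ∧ c) ≡ b ∧ (a ∧ c)
∧-exchange true  b c = refl
∧-exchange false b c = sym (∧-zeroʳ b)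

all-true : {A : Set} (xs : List A) → all (λ _ → true) xs ≡ true
all-true []       = refl
all-true (_ ∷ xs) = all-true xs

all-absorb : {A : Set} {f g : A → Bool} → (∀ x → T (g x) → T (f x)) →
  ∀ xs → all f xs ∧ all g xs ≡ all g xs
all-absorb g⇒f []       = refl
all-absorb {f = f} {g} g⇒f (x ∷ xs) with g x in gx
... | false = ∧-zeroʳ _
... | true with f x | g⇒f x (subst T (sym gx) _)
...   | true | _ = all-absorb g⇒f xs

≤ᵇ-strict : ∀ {k} (x y : Fin k) → y ≢ x → (toℕ x ≤ᵇ toℕ y) ≡ (suc (toℕ x) ≤ᵇ toℕ y)
≤ᵇ-strict x y y≢x with toℕ x <? toℕ y
... | yes x<y = trans (dec-true (toℕ x ≤? toℕ y) (<⇒≤ x<y)) (sym (dec-true (toℕ x <? toℕ y) x<y))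
... | no  x≮y = trans (dec-false (toℕ x ≤? toℕ y) (λ x≤y → x≮y (≤∧≢⇒< x≤y (λ e → y≢x (toℕ-injective (sym e))))))
                      (sym (dec-false (toℕ x <? toℕ y) x≮y))

avoid-above : ∀ {k} (x : Fin k) ys →
  not (any (λ y → ⌊ y ≟ x ⌋) ys) ∧ all (λ y → toℕ x ≤ᵇ toℕ y) ys ≡ all (λ y → suc (toℕ x) ≤ᵇ toℕ y) ys
avoid-above x []       = refl
avoid-above x (y ∷ ys) with y ≟ x
... | yes refl rewrite dec-false (suc (toℕ y) ≤? toℕ y) (n≮n (toℕ y)) = refl
... | no  y≢x  rewrite ≤ᵇ-strict x y y≢x =
  trans (∧-exchange (not (any (λ y → ⌊ y ≟ x ⌋) ys)) (suc (toℕ x) ≤ᵇ toℕ y) _)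
        (cong ((suc (toℕ x) ≤ᵇ toℕ y) ∧_) (avoid-above x ys))

rgs-distinct : ∀ {k L} m r (v : Vec (Fin k) L) →
  rgs m (toList v) ∧ (firstDistinct r (toList v) ∧ all (λ y → m ≤ᵇ toℕ y) (take r (toList v)))
    ≡ canonicalRun m r v
rgs-distinct m zero    v       = ∧-identityʳ _
rgs-distinct m (suc r) []      = refl
rgs-distinct m (suc r) (x ∷ v) with <-cmp (toℕ x) m
... | tri< x<m _ _ rewrite dec-false (m ≤? toℕ x) (<⇒≱ x<m) | dec-false (toℕ x ≟ℕ m) (<⇒≢ x<m) =
  trans (cong (((toℕ x ≤ᵇ m) ∧ rgs (m ⊔ suc (toℕ x)) (toList v)) ∧_) (∧-zeroʳ _)) (∧-zeroʳ _)
... | tri> _ _ x>m rewrite dec-false (toℕ x ≤? m) (<⇒≱ x>m) | dec-false (toℕ x ≟ℕ m) (>⇒≢ x>m) = refl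
... | tri≈ _ refl _
  rewrite dec-true (toℕ x ≤? toℕ x) ≤-refl | dec-true (toℕ x ≟ℕ toℕ x) refl
        | m≤n⇒m⊔n≡n (n≤1+n (toℕ x)) =
  trans (cong (rgs (suc (toℕ x)) l ∧_) regroup) (rgs-distinct (suc (toℕ x)) r v)
  where
  open ≡-Reasoning
  l = toList v
  fresh = any (λ y → ⌊ y ≟ x ⌋) (take r l)
  above = all (λ y → toℕ x ≤ᵇ toℕ y) (take r l)
  regroup : (not fresh ∧ firstDistinct r l) ∧ above ≡ firstDistinct r l ∧ all (λ y → suc (toℕ x) ≤ᵇ toℕ y) (take r l)
  regroup = begin
    (not fresh ∧ firstDistinct r l) ∧ above  ≡⟨ ∧-assoc (not fresh) _ _ ⟩
    not fresh ∧ (firstDistinct r l ∧ above)  ≡⟨ ∧-exchange (not fresh) (firstDistinct r l) above ⟩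
    firstDistinct r l ∧ (not fresh ∧ above)  ≡⟨ cong (firstDistinct r l ∧_) (avoid-above x (take r l)) ⟩
    firstDistinct r l ∧ all (λ y → suc (toℕ x) ≤ᵇ toℕ y) (take r l) ∎

Large : ∀ {k} → ℕ → (Fin k → ℕ) → List (Fin k) → Set
Large s seed l = ∀ b → s ≤ seed b + blockSize b l

large : ∀ {k} → ℕ → (Fin k → ℕ) → List (Fin k) → Bool
large {k} s seed l = all (λ b → s ≤ᵇ seed b + blockSize b l) (allFin k)

large⇒Large : ∀ {k} s (seed : Fin k → ℕ) l → T (large s seed l) → Large s seed l
large⇒Large {k} s seed l t b =
  ≤ᵇ⇒≤ s _ (All.lookup (all⁺ (λ b → s ≤ᵇ seed b + blockSize b l) (allFin k) t) (∈-allFin b))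

Large⇒large : ∀ {k} s (seed : Fin k → ℕ) l → Large s seed l → T (large s seed l)
Large⇒large s seed l h = all⁻ (λ b → s ≤ᵇ seed b + blockSize b l) (tabulate⁺ (λ b → ≤⇒≤ᵇ (h b)))

large-ext : ∀ {k k′} s s′ (seed : Fin k → ℕ) (seed′ : Fin k′ → ℕ) l l′ →
  (Large s seed l → Large s′ seed′ l′) → (Large s′ seed′ l′ → Large s seed l) →
  large s seed l ≡ large s′ seed′ l′
large-ext s s′ seed seed′ l l′ f g =
  bool-ext (Large⇒large s′ seed′ l′ ∘ f ∘ large⇒Large s seed l) (Large⇒large s seed l ∘ g ∘ large⇒Large s′ seed′ l′)

allLarge : ∀ {k L} → ℕ → Vec (Fin k) L → Bool
allLarge s v = large s (λ _ → 0) (toList v)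

-- Canonical form of the defining predicate: a restricted growth string has pairwise
-- distinct first r labels exactly when these are 0, 1, …, r−1, and for s ≥ 1 the
-- nonemptiness of the blocks is implied by their size condition.
valid-canonical : ∀ s r n k → 1 ≤ s → ∀ v → valid s r n k v ≡ canonicalRun 0 r v ∧ allLarge s v
valid-canonical s r n k 1≤s v = begin
  rgs 0 l ∧ (nonempty ∧ (sized ∧ fd))     ≡⟨ cong (rgs 0 l ∧_) (∧-assoc nonempty sized fd) ⟨
  rgs 0 l ∧ ((nonempty ∧ sized) ∧ fd)     ≡⟨ cong (λ b → rgs 0 l ∧ (b ∧ fd)) (all-absorb s⇒1 (allFin k)) ⟩
  rgs 0 l ∧ (sized ∧ fd)                  ≡⟨ cong (rgs 0 l ∧_) (∧-comm sized fd) ⟩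
  rgs 0 l ∧ (fd ∧ sized)                  ≡⟨ ∧-assoc (rgs 0 l) fd sized ⟨
  (rgs 0 l ∧ fd) ∧ sized                  ≡⟨ cong (λ b → (rgs 0 l ∧ b) ∧ sized) (∧-identityʳ fd) ⟨
  (rgs 0 l ∧ (fd ∧ true)) ∧ sized         ≡⟨ cong (λ b → (rgs 0 l ∧ (fd ∧ b)) ∧ sized) (all-true (take r l)) ⟨
  (rgs 0 l ∧ (fd ∧ all (λ _ → true) (take r l))) ∧ sized ≡⟨ cong (_∧ sized) (rgs-distinct 0 r v) ⟩
  canonicalRun 0 r v ∧ sized              ∎
  where
  open ≡-Reasoning
  l = toList v
  nonempty = all (λ b → 1 ≤ᵇ blockSize b l) (allFin k)
  sized = all (λ b → s ≤ᵇ blockSize b l) (allFin k)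
  fd = firstDistinct r l
  s⇒1 : ∀ b → T (s ≤ᵇ blockSize b l) → T (1 ≤ᵇ blockSize b l)
  s⇒1 b t = ≤⇒≤ᵇ (≤-trans 1≤s (≤ᵇ⇒≤ s _ t))

blockSize-relabel : ∀ {k} (π : Permutation k k) c (l : List (Fin k)) →
  blockSize c (map (π ⟨$⟩ʳ_) l) ≡ blockSize (π ⟨$⟩ˡ c) l
blockSize-relabel π c []      = refl
blockSize-relabel π c (x ∷ l) with (π ⟨$⟩ʳ x) ≟ c | x ≟ (π ⟨$⟩ˡ c)
... | yes _   | yes _   = cong suc (blockSize-relabel π c l)
... | no  _   | no  _   = blockSize-relabel π c l
... | yes πx≡c | no  x≢c′ = ⊥-elim (x≢c′ (trans (sym (Perm.inverseˡ π)) (cong (π ⟨$⟩ˡ_) πx≡c)))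
... | no  πx≢c | yes x≡c′ = ⊥-elim (πx≢c (trans (cong (π ⟨$⟩ʳ_) x≡c′) (Perm.inverseʳ π)))

allLarge-relabel : ∀ {k L} s (π : Permutation k k) (v : Vec (Fin k) L) → allLarge s (mapᵥ (π ⟨$⟩ʳ_) v) ≡ allLarge s v
allLarge-relabel s π v rewrite toList-map (π ⟨$⟩ʳ_) v =
  large-ext s s _ _ (map (π ⟨$⟩ʳ_) l) l
    (λ h b → subst (s ≤_) (trans (blockSize-relabel π (π ⟨$⟩ʳ b) l) (cong (λ c → blockSize c l) (Perm.inverseˡ π))) (h (π ⟨$⟩ʳ b)))
    (λ h c → subst (s ≤_) (sym (blockSize-relabel π c l)) (h (π ⟨$⟩ˡ c)))
  where l = toList v

S-unlabelled : ∀ s r n k → 1 ≤ s →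
  S s r n k * (k ∸ r) ! ≡ countVec n k (λ v → startsWithRun 0 r v ∧ allLarge s v)
S-unlabelled s r n k 1≤s =
  trans (cong (_* (k ∸ r) !) (countVec-cong n k (valid-canonical s r n k 1≤s)))
        (symmetrisation k n 0 r (allLarge s) (λ π _ v → allLarge-relabel s π v) covering)
  where
  covering : Covering 0 (allLarge {k} {n} s)
  covering v t b _ = ≤-trans 1≤s (large⇒Large s (λ _ → 0) (toList v) t b)

-- seed m b = 1 exactly when b < m: a run 0, …, m−1 has put one element into block b.
seed : ∀ {k} → ℕ → Fin k → ℕ
seed m b = if does (toℕ b <? m) then 1 else 0

seed-below : ∀ {k m} (b : Fin k) → toℕ b < m → seed m b ≡ 1
seed-below {m = m} b b<m rewrite dec-true (toℕ b <? m) b<m = refl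

seed-above : ∀ {k m} (b : Fin k) → m ≤ toℕ b → seed m b ≡ 0
seed-above {m = m} b m≤b rewrite dec-false (toℕ b <? m) (≤⇒≯ m≤b) = refl

seed-step : ∀ {k m} (b : Fin k) → toℕ b ≢ m → seed (suc m) b ≡ seed m b
seed-step {m = m} b b≢m with toℕ b <? m
... | yes b<m = trans (seed-below b (m<n⇒m<1+n b<m)) (sym (seed-below b b<m))
... | no  b≮m = trans (seed-above b (≤∧≢⇒< (≮⇒≥ b≮m) (b≢m ∘ sym))) (sym (seed-above b (≮⇒≥ b≮m)))

large-cong : ∀ {k} s (seed₁ seed₂ : Fin k → ℕ) l₁ l₂ →
  (∀ b → seed₁ b + blockSize b l₁ ≡ seed₂ b + blockSize b l₂) → large s seed₁ l₁ ≡ large s seed₂ l₂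
large-cong s seed₁ seed₂ l₁ l₂ e =
  large-ext s s seed₁ seed₂ l₁ l₂ (λ h b → subst (s ≤_) (e b) (h b)) (λ h b → subst (s ≤_) (sym (e b)) (h b))

large-seed : ∀ {k} s m (c : Fin k) l → toℕ c ≡ m → large s (seed m) (c ∷ l) ≡ large s (seed (suc m)) l
large-seed s m c l c≡m = large-cong s (seed m) (seed (suc m)) (c ∷ l) l sizes
  where
  sizes : ∀ b → seed m b + blockSize b (c ∷ l) ≡ seed (suc m) b + blockSize b l
  sizes b = compare (c ≟ b)
    where
    compare : Dec (c ≡ b) → seed m b + blockSize b (c ∷ l) ≡ seed (suc m) b + blockSize b l
    compare (yes refl) = trans (cong₂ _+_ (seed-above c (≤-reflexive (sym c≡m))) (blockSize-hit c l))
                               (cong (_+ blockSize c l) (sym (seed-below c (s≤s (≤-reflexive c≡m)))))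
    compare (no c≢b)  = cong₂ _+_ (sym (seed-step b (λ b≡m → c≢b (toℕ-injective (trans c≡m (sym b≡m))))))
                                  (blockSize-skip l c≢b)

seededCount : ℕ → ℕ → ℕ → ℕ → ℕ
seededCount s m N k = countVec N k (λ w → large s (seed m) (toList w))

peel : ∀ k s j m L → m + j ≤ k →
  countVec (j + L) k (λ v → startsWithRun m j v ∧ large s (seed m) (toList v)) ≡ seededCount s (m + j) L k
peel k s zero m L _ = cong (λ t → seededCount s t L k) (sym (+-identityʳ m))
peel zero s (suc j) m L m+j≤0 = ⊥-elim (<⇒≱ (s≤s z≤n) (subst (_≤ 0) (+-suc m j) m+j≤0))
peel (suc k) s (suc j) m L m+j≤k = begin
  countVec (suc (j + L)) (suc k) (λ v → startsWithRun m (suc j) v ∧ large s (seed m) (toList v))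
    ≡⟨ countVec-∷ (j + L) (suc k) _ ⟩
  sum f
    ≡⟨ sum-single f c off-run ⟩
  f c
    ≡⟨ countVec-cong (j + L) (suc k) on-run ⟩
  countVec (j + L) (suc k) (λ v → startsWithRun (suc m) j v ∧ large s (seed (suc m)) (toList v))
    ≡⟨ peel (suc k) s j (suc m) L (subst (_≤ suc k) (+-suc m j) m+j≤k) ⟩
  seededCount s (suc m + j) L (suc k)
    ≡⟨ cong (λ t → seededCount s t L (suc k)) (+-suc m j) ⟨
  seededCount s (m + suc j) L (suc k) ∎
  where
  open ≡-Reasoning
  m<k : m < suc k
  m<k = <-≤-trans (m<m+n m (s≤s z≤n)) m+j≤k
  c : Fin (suc k)
  c = fromℕ< m<k
  f : Fin (suc k) → ℕ
  f x = countVec (j + L) (suc k) (λ v → (does (toℕ x ≟ℕ m) ∧ startsWithRun (suc m) j v) ∧ large s (seed m) (x ∷ toList v))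
  off-run : ∀ x → x ≢ c → f x ≡ 0
  off-run x x≢c rewrite dec-false (toℕ x ≟ℕ m) (λ x≡m → x≢c (toℕ-injective (trans x≡m (sym (toℕ-fromℕ< m<k))))) =
    countVec-none (j + L) (suc k)
  on-run : ∀ v → (does (toℕ c ≟ℕ m) ∧ startsWithRun (suc m) j v) ∧ large s (seed m) (c ∷ toList v)
               ≡ startsWithRun (suc m) j v ∧ large s (seed (suc m)) (toList v)
  on-run v rewrite dec-true (toℕ c ≟ℕ m) (toℕ-fromℕ< m<k) =
    cong (startsWithRun (suc m) j v ∧_) (large-seed s m c (toList v) (toℕ-fromℕ< m<k))

others : ∀ {k} → Fin (suc k) → List (Fin (suc k)) → List (Fin k)
others a []      = []
others a (x ∷ l) with x ≟ a
... | yes _   = others a l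
... | no  x≢a = punchOut (x≢a ∘ sym) ∷ others a l

others-hit : ∀ {k} (a : Fin (suc k)) l → others a (a ∷ l) ≡ others a l
others-hit a l with a ≟ a
... | yes _   = refl
... | no  a≢a = ⊥-elim (a≢a refl)

others-punchIn : ∀ {k} (a : Fin (suc k)) y l → others a (punchIn a y ∷ l) ≡ y ∷ others a l
others-punchIn a y l with punchIn a y ≟ a
... | yes y′≡a = ⊥-elim (punchInᵢ≢i a y y′≡a)
... | no  y′≢a = cong (_∷ others a l) (punchIn-injective a _ _ (punchIn-punchOut (y′≢a ∘ sym)))

blockSize-others : ∀ {k} (a : Fin (suc k)) y l → blockSize (punchIn a y) l ≡ blockSize y (others a l)
blockSize-others a y []      = refl
blockSize-others a y (x ∷ l) with x ≟ a
... | yes refl = trans (blockSize-skip l (punchInᵢ≢i x y ∘ sym)) (blockSize-others x y l)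
... | no  x≢a with x ≟ punchIn a y | punchOut (x≢a ∘ sym) ≟ y
...   | yes _   | yes _   = cong suc (blockSize-others a y l)
...   | no  _   | no  _   = blockSize-others a y l
...   | yes x≡y′ | no  x′≢y = ⊥-elim (x′≢y (punchIn-injective a _ _ (trans (punchIn-punchOut (x≢a ∘ sym)) x≡y′)))
...   | no  x≢y′ | yes x′≡y = ⊥-elim (x≢y′ (trans (sym (punchIn-punchOut (x≢a ∘ sym))) (cong (punchIn a) x′≡y)))

-- Pascal's rule, in the form needed for removing one element from a counted set:
-- the factor f is evaluated at the number of remaining elements.
pascal-step : ∀ N j (f : ℕ → ℕ) →
  (N C j) * f (N ∸ j) + (N C suc j) * f (suc (N ∸ suc j)) ≡ (suc N C suc j) * f (N ∸ j)
pascal-step N j f with j <? N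
... | yes j<N = begin
  (N C j) * f (N ∸ j) + (N C suc j) * f (suc (N ∸ suc j)) ≡⟨ cong (λ t → (N C j) * f (N ∸ j) + (N C suc j) * f t) (+-∸-assoc 1 j<N) ⟨
  (N C j) * f (N ∸ j) + (N C suc j) * f (N ∸ j)           ≡⟨ *-distribʳ-+ (f (N ∸ j)) (N C j) (N C suc j) ⟨
  ((N C j) + (N C suc j)) * f (N ∸ j)                     ≡⟨ cong (_* f (N ∸ j)) (nCk+nC[k+1]≡[n+1]C[k+1] N j) ⟩
  (suc N C suc j) * f (N ∸ j)                             ∎
  where open ≡-Reasoning
... | no  j≮N = begin
  (N C j) * f (N ∸ j) + (N C suc j) * f (suc (N ∸ suc j)) ≡⟨ cong (λ c → (N C j) * f (N ∸ j) + c * f (suc (N ∸ suc j))) N<j+1 ⟩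
  (N C j) * f (N ∸ j) + 0                                 ≡⟨ cong ((N C j) * f (N ∸ j) +_) (*-zeroˡ (f (N ∸ j))) ⟨
  (N C j) * f (N ∸ j) + 0 * f (N ∸ j)                     ≡⟨ *-distribʳ-+ (f (N ∸ j)) (N C j) 0 ⟨
  ((N C j) + 0) * f (N ∸ j)                               ≡⟨ cong (λ c → ((N C j) + c) * f (N ∸ j)) N<j+1 ⟨
  ((N C j) + (N C suc j)) * f (N ∸ j)                     ≡⟨ cong (_* f (N ∸ j)) (nCk+nC[k+1]≡[n+1]C[k+1] N j) ⟩
  (suc N C suc j) * f (N ∸ j)                             ∎
  where
  open ≡-Reasoning
  N<j+1 : N C suc j ≡ 0
  N<j+1 = k>n⇒nCk≡0 (s≤s (≮⇒≥ j≮N))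

-- Choosing block a: a vector of length N over k+1 labels whose block a has exactly
-- j elements is a j-subset of the positions together with a vector of length N ∸ j
-- over the remaining k labels.
choose-block : ∀ {k} (a : Fin (suc k)) N j (R : List (Fin k) → Bool) →
  countVec N (suc k) (λ w → does (blockSize a (toList w) ≟ℕ j) ∧ R (others a (toList w)))
    ≡ (N C j) * countVec (N ∸ j) k (R ∘ toList)
choose-block a zero zero    R with R []
... | true  = refl
... | false = refl
choose-block {k} a zero (suc j) R = sym (cong (_* countVec 0 k (R ∘ toList)) (k>n⇒nCk≡0 {0} {suc j} (s≤s z≤n)))
choose-block {k} a (suc N) j R = begin
  countVec (suc N) (suc k) Q                           ≡⟨ countVec-∷ N (suc k) Q ⟩
  sum f                                                ≡⟨ sum-remove {k} {a} f ⟩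
  f a + sum (f ∘ punchIn a)                            ≡⟨ cong₂ _+_ (in-a j) (sum-cong-≗ {k} not-in-a) ⟩
  inA j + sum (λ y → (N C j) * countVec (N ∸ j) k (R′ y))  ≡⟨ cong (inA j +_) (*-distribˡ-sum {k} (N C j) _) ⟨
  inA j + (N C j) * sum (λ y → countVec (N ∸ j) k (R′ y))  ≡⟨ cong (λ t → inA j + (N C j) * t) (countVec-∷ (N ∸ j) k (R ∘ toList)) ⟨
  inA j + (N C j) * countVec (suc (N ∸ j)) k (R ∘ toList)  ≡⟨ combine j ⟩
  (suc N C j) * countVec (suc N ∸ j) k (R ∘ toList)    ∎
  where
  open ≡-Reasoning
  Q : Vec (Fin (suc k)) (suc N) → Bool
  Q w = does (blockSize a (toList w) ≟ℕ j) ∧ R (others a (toList w))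
  f : Fin (suc k) → ℕ
  f x = countVec N (suc k) (λ v → Q (x ∷ v))
  R′ : Fin k → Vec (Fin k) (N ∸ j) → Bool
  R′ y u = R (y ∷ toList u)
  inA : ℕ → ℕ
  inA zero    = 0
  inA (suc j) = (N C j) * countVec (N ∸ j) k (R ∘ toList)
  in-a : ∀ j → countVec N (suc k) (λ v → does (blockSize a (a ∷ toList v) ≟ℕ j) ∧ R (others a (a ∷ toList v))) ≡ inA j
  in-a j = trans (countVec-cong N (suc k) (λ v → cong₂ (λ size rest → does (size ≟ℕ j) ∧ R rest)
                                                      (blockSize-hit a (toList v)) (others-hit a (toList v))))
                 (in-a′ j)
    where
    in-a′ : ∀ j → countVec N (suc k) (λ v → does (suc (blockSize a (toList v)) ≟ℕ j) ∧ R (others a (toList v))) ≡ inA j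
    in-a′ zero    = countVec-none N (suc k)
    in-a′ (suc j) = choose-block a N j R
  not-in-a : ∀ y → f (punchIn a y) ≡ (N C j) * countVec (N ∸ j) k (R′ y)
  not-in-a y = trans (countVec-cong N (suc k) (λ v → cong₂ (λ size rest → does (size ≟ℕ j) ∧ R rest)
                                                          (blockSize-skip (toList v) (punchInᵢ≢i a y)) (others-punchIn a y (toList v))))
                     (choose-block a N j (λ l → R (y ∷ l)))
  combine : ∀ j → inA j + (N C j) * countVec (suc (N ∸ j)) k (R ∘ toList) ≡ (suc N C j) * countVec (suc N ∸ j) k (R ∘ toList)
  combine zero    = refl
  combine (suc j) = pascal-step N j (λ L → countVec L k (R ∘ toList))

seed-punchIn : ∀ {k} (a : Fin (suc k)) y → seed (suc (toℕ a)) (punchIn a y) ≡ seed (toℕ a) y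
seed-punchIn fzero    y        = refl
seed-punchIn (fsuc a) fzero    = refl
seed-punchIn (fsuc a) (fsuc y) = seed-punchIn a y

∀-punchIn : ∀ {k} {P : Fin (suc k) → Set} (a : Fin (suc k)) → P a → (∀ y → P (punchIn a y)) → ∀ b → P b
∀-punchIn {P = P} a Pa Py b with b ≟ a
... | yes refl = Pa
... | no  b≢a  = subst P (punchIn-punchOut (b≢a ∘ sym)) (Py (punchOut (b≢a ∘ sym)))

module BlockSplit {k : ℕ} (s′ : ℕ) (a : Fin (suc k)) where

  s r : ℕ
  s = suc s′
  r = toℕ a

  -- If block a has exactly s − 1 elements, it is complete with its seed, and the
  -- condition concerns only the other blocks, with seeds at 0, …, r−1.
  Large-exact : ∀ l → blockSize a l ≡ s′ →
    (Large s (seed (suc r)) l → Large s (seed r) (others a l)) × (Large s (seed r) (others a l) → Large s (seed (suc r)) l)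
  Large-exact l a-full = to , from
    where
    sizes : ∀ y → seed (suc r) (punchIn a y) + blockSize (punchIn a y) l ≡ seed r y + blockSize y (others a l)
    sizes y = cong₂ _+_ (seed-punchIn a y) (blockSize-others a y l)
    to : Large s (seed (suc r)) l → Large s (seed r) (others a l)
    to h y = subst (s ≤_) (sizes y) (h (punchIn a y))
    from : Large s (seed r) (others a l) → Large s (seed (suc r)) l
    from h = ∀-punchIn a (subst (λ t → s ≤ t + blockSize a l) (sym (seed-below a ≤-refl)) (≤-reflexive (cong suc (sym a-full))))
                         (λ y → subst (s ≤_) (sym (sizes y)) (h y))

  -- Otherwise block a needs no seed: its size is at least s either way.
  Large-inexact : ∀ l → blockSize a l ≢ s′ →
    (Large s (seed (suc r)) l → Large s (seed r) l) × (Large s (seed r) l → Large s (seed (suc r)) l)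
  Large-inexact l a-open = to , from
    where
    unseeded : ∀ {t} → t ≤ blockSize a l → t ≤ seed r a + blockSize a l
    unseeded = subst (_ ≤_) (cong (_+ blockSize a l) (sym (seed-above a ≤-refl)))
    seeded : s ≤ seed (suc r) a + blockSize a l → s ≤ suc (blockSize a l)
    seeded = subst (s ≤_) (cong (_+ blockSize a l) (seed-below a ≤-refl))
    elsewhere : ∀ y → seed (suc r) (punchIn a y) ≡ seed r (punchIn a y)
    elsewhere y = seed-step (punchIn a y) (punchInᵢ≢i a y ∘ toℕ-injective)
    to : Large s (seed (suc r)) l → Large s (seed r) l
    to h = ∀-punchIn a (unseeded (s≤s⁻¹ (≤∧≢⇒< (seeded (h a)) (a-open ∘ suc-injective ∘ sym))))
                       (λ y → subst (λ t → s ≤ t + blockSize (punchIn a y) l) (elsewhere y) (h (punchIn a y)))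
    from : Large s (seed r) l → Large s (seed (suc r)) l
    from h = ∀-punchIn a (subst (s ≤_) (sym (cong (_+ blockSize a l) (seed-below a ≤-refl)))
                                (m≤n⇒m≤1+n (subst (s ≤_) (cong (_+ blockSize a l) (seed-above a ≤-refl)) (h a))))
                         (λ y → subst (λ t → s ≤ t + blockSize (punchIn a y) l) (sym (elsewhere y)) (h (punchIn a y)))

  large-exact : ∀ l → large s (seed (suc r)) l ∧ does (blockSize a l ≟ℕ s′) ≡ does (blockSize a l ≟ℕ s′) ∧ large s (seed r) (others a l)
  large-exact l with blockSize a l ≟ℕ s′
  ... | yes full rewrite dec-true (blockSize a l ≟ℕ s′) full =
    trans (∧-identityʳ _) (large-ext s s _ _ l (others a l) (proj₁ (Large-exact l full)) (proj₂ (Large-exact l full)))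
  ... | no  open′ rewrite dec-false (blockSize a l ≟ℕ s′) open′ = ∧-zeroʳ _

  large-inexact : ∀ l → large s (seed (suc r)) l ∧ not (does (blockSize a l ≟ℕ s′)) ≡ large s (seed r) l
  large-inexact l with blockSize a l ≟ℕ s′
  ... | yes full rewrite dec-true (blockSize a l ≟ℕ s′) full = trans (∧-zeroʳ _) (sym (bool-ext too-small (λ ())))
    where
    -- Unseeded, block a is too small.
    too-small : T (large s (seed r) l) → T false
    too-small t = ⊥-elim (<⇒≱ (s≤s (≤-reflexive (trans (cong (_+ blockSize a l) (seed-above a ≤-refl)) full)))
                               (large⇒Large s (seed r) l t a))
  ... | no  open′ rewrite dec-false (blockSize a l ≟ℕ s′) open′ =
    trans (∧-identityʳ _) (large-ext s s _ _ l l (proj₁ (Large-inexact l open′)) (proj₂ (Large-inexact l open′)))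

  split-block : ∀ N → seededCount s (suc r) N (suc k) ≡ (N C s′) * seededCount s r (N ∸ s′) k + seededCount s r N (suc k)
  split-block N = trans (countVec-split N (suc k) _ (λ w → does (blockSize a (toList w) ≟ℕ s′)))
    (cong₂ _+_ (trans (countVec-cong N (suc k) (large-exact ∘ toList)) (choose-block a N s′ (large s (seed r))))
               (countVec-cong N (suc k) (large-inexact ∘ toList)))

split-at : ∀ s′ r k N → r < suc k →
  seededCount (suc s′) (suc r) N (suc k)
    ≡ (N C s′) * seededCount (suc s′) r (N ∸ s′) k + seededCount (suc s′) r N (suc k)
split-at s′ r k N r<k+1 = subst Split (toℕ-fromℕ< r<k+1) (BlockSplit.split-block s′ (fromℕ< r<k+1) N)
  where
  Split : ℕ → Set
  Split t = seededCount (suc s′) (suc t) N (suc k) ≡ (N C s′) * seededCount (suc s′) t (N ∸ s′) k + seededCount (suc s′) t N (suc k)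

S-seeded : ∀ s r N k → 1 ≤ s → r ≤ k → S s r (r + N) k * (k ∸ r) ! ≡ seededCount s r N k
S-seeded s r N k 1≤s r≤k = begin
  S s r (r + N) k * (k ∸ r) !                                                      ≡⟨ S-unlabelled s r (r + N) k 1≤s ⟩
  countVec (r + N) k (λ v → startsWithRun 0 r v ∧ allLarge s v)                   ≡⟨ countVec-cong (r + N) k unseeded ⟩
  countVec (r + N) k (λ v → startsWithRun 0 r v ∧ large s (seed 0) (toList v))    ≡⟨ peel k s r 0 N r≤k ⟩
  seededCount s r N k                                                              ∎
  where
  open ≡-Reasoning
  unseeded : ∀ v → startsWithRun 0 r v ∧ allLarge s v ≡ startsWithRun 0 r v ∧ large s (seed 0) (toList v)
  unseeded v = cong (startsWithRun 0 r v ∧_)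
    (large-cong s (λ _ → 0) (seed 0) (toList v) (toList v) (λ b → cong (_+ blockSize b (toList v)) (sym (seed-above b z≤n))))

recurrence : ∀ s′ r′ k′ M → r′ ≤ k′ →
  S (suc s′) (suc r′) (suc r′ + (s′ + M)) (suc k′)
    ≡ ((s′ + M) C s′) * S (suc s′) r′ (r′ + M) k′ + suc (k′ ∸ r′) * S (suc s′) r′ (r′ + (s′ + M)) (suc k′)
recurrence s′ r′ k′ M r′≤k′ = *-cancelʳ-≡ _ _ F {{(k′ ∸ r′) !≢0}} (begin
  X * F                                                      ≡⟨ S-seeded s (suc r′) N k (s≤s z≤n) (s≤s r′≤k′) ⟩
  seededCount s (suc r′) N k                                 ≡⟨ split-at s′ r′ k′ N (s≤s r′≤k′) ⟩
  Bin * seededCount s r′ (N ∸ s′) k′ + seededCount s r′ N k  ≡⟨ cong (λ t → Bin * seededCount s r′ t k′ + Rest) (m+n∸m≡n s′ M) ⟩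
  Bin * seededCount s r′ M k′ + Rest                         ≡⟨ cong₂ (λ p q → Bin * p + q) (S-seeded s r′ M k′ (s≤s z≤n) r′≤k′)
                                                                  (S-seeded s r′ N k (s≤s z≤n) (m≤n⇒m≤1+n r′≤k′)) ⟨
  Bin * (A * F) + B * (k ∸ r′) !                             ≡⟨ cong (λ t → Bin * (A * F) + B * t) (factorial-step k r′ (s≤s r′≤k′)) ⟩
  Bin * (A * F) + B * ((k ∸ r′) * F)                         ≡⟨ cong (λ t → Bin * (A * F) + B * (t * F)) (+-∸-assoc 1 r′≤k′) ⟩
  Bin * (A * F) + B * (suc (k′ ∸ r′) * F)                    ≡⟨ collect Bin A B (suc (k′ ∸ r′)) F ⟩
  (Bin * A + suc (k′ ∸ r′) * B) * F                          ∎)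
  where
  open ≡-Reasoning
  open +-*-Solver
  s = suc s′
  k = suc k′
  N = s′ + M
  F = (k′ ∸ r′) !
  X = S s (suc r′) (suc r′ + N) k
  A = S s r′ (r′ + M) k′
  B = S s r′ (r′ + N) k
  Bin = N C s′
  Rest = seededCount s r′ N k
  collect : ∀ c a b t f → c * (a * f) + b * (t * f) ≡ (c * a + t * b) * f
  collect = solve 5 (λ c a b t f → c :* (a :* f) :+ b :* (t :* f) := (c :* a :+ t :* b) :* f) refl

mainTheorem14 : (s r k n : ℕ) → 1 ≤ s → 1 ≤ r → r ≤ k → s * k ≤ n →
    S s r n k ≡ ((n ∸ r) C (s ∸ 1)) * S s (r ∸ 1) (n ∸ s) (k ∸ 1)
    + (k ∸ r + 1) * S s (r ∸ 1) (n ∸ 1) k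
mainTheorem14 (suc s′) (suc r′) (suc k′) n _ _ (s≤s r′≤k′) sk≤n =
  subst Recurrence n≡ (trans (recurrence s′ r′ k′ M r′≤k′) (cong₂ _+_
    (cong₂ _*_ (cong (_C s′) (sym (m+n∸m≡n r′ (s′ + M)))) (cong (λ t → S (suc s′) r′ t k′) (sym after-s)))
    (cong (_* S (suc s′) r′ (r′ + (s′ + M)) (suc k′)) (+-comm 1 (k′ ∸ r′)))))
  where
  Recurrence : ℕ → Set
  Recurrence n = S (suc s′) (suc r′) n (suc k′) ≡ ((n ∸ suc r′) C s′) * S (suc s′) r′ (n ∸ suc s′) k′
                 + (k′ ∸ r′ + 1) * S (suc s′) r′ (n ∸ 1) (suc k′)
  -- n ≥ s·k ≥ r + s′, so n = r + s′ + M.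
  enough : suc r′ + s′ ≤ n
  enough = ≤-trans (+-mono-≤ (s≤s r′≤k′) (m≤m*n s′ (suc k′))) sk≤n
  M = n ∸ (suc r′ + s′)
  n≡ : suc r′ + (s′ + M) ≡ n
  n≡ = trans (sym (+-assoc (suc r′) s′ M)) (m+[n∸m]≡n enough)
  after-s : r′ + (s′ + M) ∸ s′ ≡ r′ + M
  after-s = trans (cong (_∸ s′) (+-exchange r′ s′ M)) (m+n∸m≡n s′ (r′ + M))
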